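{- For $n\ge0$ let $\mathcal R_n$ be the set of zigzag knight's paths of size $2n$ (ending on the $x$-axis), $\mathcal R=\bigcup_n\mathcal R_n$, and let $\mathcal M_n$ be the set of peakless Motzkin paths of length $n$, $\mathcal M=\bigcup_n\mathcal M_n$. Define $\psi:\mathcal R\to\mathcal M$ recursively (writing paths as words): $\psi(\epsilon)=F$; $\psi(E\bar E\beta)=U\psi(\beta)D$; $\psi(N\bar N\beta)=F\psi(\beta)$; $\psi(N\bar E\beta E\bar N\gamma)=U\psi(\beta)D\psi(\gamma)$, for $\beta,\gamma\in\mathcal R$. Then for every $n\ge0$, $\psi$ induces a bijection between $\mathcal R_n$ and $\mathcal M_{n+1}$.
   Context: Let $N=(1,2)$, $\bar N=(1,-2)$, $E=(2,1)$, $\bar E=(2,-1)$; $N,E$ are up-steps and $\bar N,\bar E$ are down-steps. A knight's path is a lattice path in $\mathbb N^2$ starting at $(0,0)$, ending on the $x$-axis, with steps in $\{N,\bar N,E,\bar E\}$. A zigzag knight's path is a knight's path in which consecutive steps alternate between up-steps and down-steps; $\epsilon$ is the empty path. The size of a path is the abscissa of its last point. Every nonempty zigzag knight's path can be written uniquely in one of the forms $N\bar N\beta$, $E\bar E\beta$, $N\bar E\beta E\bar N\gamma$ with $\beta,\gamma$ (possibly empty) zigzag knight's paths. A peakless Motzkin path of length $n$ is a lattice path in $\mathbb N^2$ from $(0,0)$ to $(n,0)$ with steps $U=(1,1)$, $D=(1,-1)$, $F=(1,0)$ containing no occurrence of $UD$ (consecutive steps $U$ then $D$). -}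

module Defs where

open import Data.Nat using (ℕ; zero; suc; _+_; _*_; _∸_)
open import Data.Bool using (Bool; true; false)
open import Data.List using (List; []; _∷_; _++_; [_]; length; map; take)
open import Data.Nat.ListAction using (sum)
open import Data.Product using (_×_; _,_)
open import Relation.Binary.PropositionalEquality using (_≡_; _≢_)

-- N = (1,2), N̄ = (1,-2), E = (2,1), Ē = (2,-1)
data KStep : Set where
  N N̄ E Ē : KStep

isUp : KStep → Bool
isUp N = true
isUp E = true
isUp N̄ = false
isUp Ē = false

dx : KStep → ℕ
dx N = 1
dx N̄ = 1
dx E = 2
dx Ē = 2

-- KPathFrom h w : the word w, started at height h, stays in ℕ² (height ≥ 0)
-- and ends on the x-axis (height 0).
data KPathFrom : ℕ → List KStep → Set where
  kend : KPathFrom 0 []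
  kN   : ∀ {h w} → KPathFrom (2 + h) w → KPathFrom h (N ∷ w)
  kN̄   : ∀ {h w} → KPathFrom h w → KPathFrom (2 + h) (N̄ ∷ w)
  kE   : ∀ {h w} → KPathFrom (1 + h) w → KPathFrom h (E ∷ w)
  kĒ   : ∀ {h w} → KPathFrom h w → KPathFrom (1 + h) (Ē ∷ w)

KnightPath : List KStep → Set
KnightPath w = KPathFrom 0 w

data Alternating : List KStep → Set where
  alt[]  : Alternating []
  alt[_] : ∀ s → Alternating (s ∷ [])
  alt∷   : ∀ {s t w} → isUp s ≢ isUp t → Alternating (t ∷ w) → Alternating (s ∷ t ∷ w)

ZigzagKnightPath : List KStep → Set
ZigzagKnightPath w = KnightPath w × Alternating w

size : List KStep → ℕ
size w = sum (map dx w)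

InR : ℕ → List KStep → Set
InR n w = ZigzagKnightPath w × size w ≡ 2 * n

data MStep : Set where
  U D F : MStep

data MPathFrom : ℕ → List MStep → Set where
  mend : MPathFrom 0 []
  mU   : ∀ {h w} → MPathFrom (suc h) w → MPathFrom h (U ∷ w)
  mD   : ∀ {h w} → MPathFrom h w → MPathFrom (suc h) (D ∷ w)
  mF   : ∀ {h w} → MPathFrom h w → MPathFrom h (F ∷ w)

MotzkinPath : List MStep → Set
MotzkinPath w = MPathFrom 0 w

-- no occurrence of U immediately followed by D
data Peakless : List MStep → Set where
  pl[]  : Peakless []
  plU[] : Peakless (U ∷ [])
  plUU  : ∀ {w} → Peakless (U ∷ w) → Peakless (U ∷ U ∷ w)
  plUF  : ∀ {w} → Peakless (F ∷ w) → Peakless (U ∷ F ∷ w)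
  plD   : ∀ {w} → Peakless w → Peakless (D ∷ w)
  plF   : ∀ {w} → Peakless w → Peakless (F ∷ w)

InM : ℕ → List MStep → Set
InM n m = MotzkinPath m × Peakless m × length m ≡ n

stepH : KStep → ℕ → ℕ
stepH N h = 2 + h
stepH N̄ h = h ∸ 2
stepH E h = 1 + h
stepH Ē h = h ∸ 1

-- firstReturn h w: scanning w from height h ≥ 1, split w = p ++ q where p
-- ends at the first point where the height reaches 0.
firstReturn : ℕ → List KStep → List KStep × List KStep
firstReturn h [] = [] , []
firstReturn h (s ∷ w) with stepH s h
... | zero  = s ∷ [] , w
... | suc h' with firstReturn (suc h') w
...   | p , q = s ∷ p , q

-- For a word N Ē w with w = β E N̄ γ as in the unique decomposition
-- N Ē β E N̄ γ, the pair (β , γ): β is the part of w before the first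
-- return to the x-axis minus the two final steps E N̄.
splitNĒ : List KStep → List KStep × List KStep
splitNĒ w with firstReturn 1 w
... | p , q = take (length p ∸ 2) p , q

-- ψ with fuel (fuel = length of the word suffices, as each recursive call
-- is on a strictly shorter word).  Values on words that are not zigzag
-- knight's paths are irrelevant.
ψ-fuel : ℕ → List KStep → List MStep
ψ-fuel zero    _ = F ∷ []
ψ-fuel (suc k) [] = F ∷ []
ψ-fuel (suc k) (E ∷ Ē ∷ β) = U ∷ (ψ-fuel k β ++ D ∷ [])
ψ-fuel (suc k) (N ∷ N̄ ∷ β) = F ∷ ψ-fuel k β
ψ-fuel (suc k) (N ∷ Ē ∷ w) with splitNĒ w
... | β , γ = U ∷ (ψ-fuel k β ++ D ∷ ψ-fuel k γ)
ψ-fuel (suc k) _ = []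

ψ : List KStep → List MStep
ψ w = ψ-fuel (length w) w

-- Both sides are languages of derivation trees of one grammar. A zigzag
-- knight's path starts with an up-step and, ending at height 0, is a sequence
-- of up-down pairs NN̄, EĒ, NĒ, EN̄; a pair NĒ raises the height by one and is
-- closed by the first pair EN̄ bringing it back, so the paths are exactly the
-- words  ε | NN̄β | EĒβ | NĒβEN̄γ, uniquely parsed.  Likewise the nonempty
-- peakless Motzkin paths are exactly the words  F | Fβ | UβD | UβDγ, uniquely
-- parsed (β nonempty after U is what forbids peaks).  ψ translates one
-- derivation tree into the other, and a tree of size n gives a knight's path
-- of size 2n and a Motzkin path of length n + 1.
module Submission where

open import Defs
open import Data.Bool using (true; false)
open import Data.Nat using (ℕ; zero; suc; _+_; _*_; _∸_; _≤_; s≤s)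
open import Data.Nat.Properties
  using (≤-refl; ≤-trans; n≤1+n; m≤m+n; m≤n+m; m+n∸n≡m; +-identityʳ; suc-injective; *-cancelˡ-≡)
open import Data.Nat.Tactic.RingSolver using (solve-∀)
open import Data.List using (List; []; _∷_; _++_; length; take)
open import Data.List.Properties using (length-++; ∷-injective)
open import Data.Product using (Σ; ∃₂; _×_; _,_; proj₁; proj₂; map₁)
open import Data.Sum using (_⊎_; inj₁; inj₂)
open import Data.Empty using (⊥-elim)
open import Relation.Nullary using (¬_)
open import Relation.Binary.PropositionalEquality
  using (_≡_; _≢_; refl; sym; trans; cong; cong₂; subst; module ≡-Reasoning)

infixr 5 NN̄_ EĒ_ NĒ_EN̄_

data ZigzagTree : Set where
  ε        : ZigzagTree
  NN̄_ EĒ_  : ZigzagTree → ZigzagTree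
  NĒ_EN̄_   : ZigzagTree → ZigzagTree → ZigzagTree

halfSize : ZigzagTree → ℕ
halfSize ε            = 0
halfSize (NN̄ t)       = 1 + halfSize t
halfSize (EĒ t)       = 2 + halfSize t
halfSize (NĒ t EN̄ u)  = 3 + halfSize t + halfSize u

word⁺ : ZigzagTree → List KStep → List KStep
word⁺ ε           r = r
word⁺ (NN̄ t)      r = N ∷ N̄ ∷ word⁺ t r
word⁺ (EĒ t)      r = E ∷ Ē ∷ word⁺ t r
word⁺ (NĒ t EN̄ u) r = N ∷ Ē ∷ word⁺ t (E ∷ N̄ ∷ word⁺ u r)

word : ZigzagTree → List KStep
word t = word⁺ t []

motzkin⁺ : ZigzagTree → List MStep → List MStep
motzkin⁺ ε           r = F ∷ r
motzkin⁺ (NN̄ t)      r = F ∷ motzkin⁺ t r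
motzkin⁺ (EĒ t)      r = U ∷ motzkin⁺ t (D ∷ r)
motzkin⁺ (NĒ t EN̄ u) r = U ∷ motzkin⁺ t (D ∷ motzkin⁺ u r)

motzkin : ZigzagTree → List MStep
motzkin t = motzkin⁺ t []

word⁺-++ : ∀ t r s → word⁺ t (r ++ s) ≡ word⁺ t r ++ s
word⁺-++ ε           r s = refl
word⁺-++ (NN̄ t)      r s = cong (λ w → N ∷ N̄ ∷ w) (word⁺-++ t r s)
word⁺-++ (EĒ t)      r s = cong (λ w → E ∷ Ē ∷ w) (word⁺-++ t r s)
word⁺-++ (NĒ t EN̄ u) r s =
  cong (λ w → N ∷ Ē ∷ w)
    (trans (cong (λ w → word⁺ t (E ∷ N̄ ∷ w)) (word⁺-++ u r s))
           (word⁺-++ t (E ∷ N̄ ∷ word⁺ u r) s))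

motzkin⁺-++ : ∀ t r s → motzkin⁺ t (r ++ s) ≡ motzkin⁺ t r ++ s
motzkin⁺-++ ε           r s = refl
motzkin⁺-++ (NN̄ t)      r s = cong (F ∷_) (motzkin⁺-++ t r s)
motzkin⁺-++ (EĒ t)      r s = cong (U ∷_) (motzkin⁺-++ t (D ∷ r) s)
motzkin⁺-++ (NĒ t EN̄ u) r s =
  cong (U ∷_)
    (trans (cong (λ m → motzkin⁺ t (D ∷ m)) (motzkin⁺-++ u r s))
           (motzkin⁺-++ t (D ∷ motzkin⁺ u r) s))

length-word⁺ : ∀ t r → length (word⁺ t r) ≡ length (word t) + length r
length-word⁺ t r = trans (cong length (word⁺-++ t [] r)) (length-++ (word t))

length-word-≤-word⁺ : ∀ t r → length (word t) ≤ length (word⁺ t r)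
length-word-≤-word⁺ t r = subst (length (word t) ≤_) (sym (length-word⁺ t r)) (m≤m+n _ _)

length-motzkin⁺ : ∀ t r → length (motzkin⁺ t r) ≡ suc (halfSize t) + length r
length-motzkin⁺ ε           r = refl
length-motzkin⁺ (NN̄ t)      r = cong suc (length-motzkin⁺ t r)
length-motzkin⁺ (EĒ t)      r =
  trans (cong suc (length-motzkin⁺ t (D ∷ r))) (rearrange (halfSize t) (length r))
  where
  rearrange : ∀ a l → suc (suc a + suc l) ≡ suc (2 + a) + l
  rearrange = solve-∀
length-motzkin⁺ (NĒ t EN̄ u) r = begin
  suc (length (motzkin⁺ t (D ∷ motzkin⁺ u r)))
    ≡⟨ cong suc (length-motzkin⁺ t _) ⟩
  suc (suc (halfSize t) + suc (length (motzkin⁺ u r)))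
    ≡⟨ cong (λ l → suc (suc (halfSize t) + suc l)) (length-motzkin⁺ u r) ⟩
  suc (suc (halfSize t) + suc (suc (halfSize u) + length r))
    ≡⟨ rearrange (halfSize t) (halfSize u) (length r) ⟩
  suc (3 + halfSize t + halfSize u) + length r ∎
  where
  open ≡-Reasoning
  rearrange : ∀ a b l → suc (suc a + suc (suc b + l)) ≡ suc (3 + a + b) + l
  rearrange = solve-∀

size-word⁺ : ∀ t r → size (word⁺ t r) ≡ 2 * halfSize t + size r
size-word⁺ ε           r = refl
size-word⁺ (NN̄ t)      r =
  trans (cong (2 +_) (size-word⁺ t r)) (rearrange (halfSize t) (size r))
  where
  rearrange : ∀ a s → 2 + (2 * a + s) ≡ 2 * (1 + a) + s
  rearrange = solve-∀
size-word⁺ (EĒ t)      r =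
  trans (cong (4 +_) (size-word⁺ t r)) (rearrange (halfSize t) (size r))
  where
  rearrange : ∀ a s → 4 + (2 * a + s) ≡ 2 * (2 + a) + s
  rearrange = solve-∀
size-word⁺ (NĒ t EN̄ u) r = begin
  3 + size (word⁺ t (E ∷ N̄ ∷ word⁺ u r))
    ≡⟨ cong (3 +_) (size-word⁺ t _) ⟩
  3 + (2 * halfSize t + (3 + size (word⁺ u r)))
    ≡⟨ cong (λ s → 3 + (2 * halfSize t + (3 + s))) (size-word⁺ u r) ⟩
  3 + (2 * halfSize t + (3 + (2 * halfSize u + size r)))
    ≡⟨ rearrange (halfSize t) (halfSize u) (size r) ⟩
  2 * halfSize (NĒ t EN̄ u) + size r ∎
  where
  open ≡-Reasoning
  rearrange : ∀ a b s → 3 + (2 * a + (3 + (2 * b + s))) ≡ 2 * (3 + a + b) + s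
  rearrange = solve-∀

data Up : KStep → Set where
  up-N : Up N
  up-E : Up E

data Down : KStep → Set where
  down-N̄ : Down N̄
  down-Ē : Down Ē

data UpDownPairs : List KStep → Set where
  []   : UpDownPairs []
  pair : ∀ {u d w} → Up u → Down d → UpDownPairs w → UpDownPairs (u ∷ d ∷ w)

isUp-Up : ∀ {u} → Up u → isUp u ≡ true
isUp-Up up-N = refl
isUp-Up up-E = refl

isUp-Down : ∀ {d} → Down d → isUp d ≡ false
isUp-Down down-N̄ = refl
isUp-Down down-Ē = refl

up≢down : ∀ {u d} → Up u → Down d → isUp u ≢ isUp d
up≢down u d eq with trans (sym (isUp-Up u)) (trans eq (isUp-Down d))
... | ()

down-then-pairs-alternating : ∀ {d w} → Down d → UpDownPairs w → Alternating (d ∷ w)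
down-then-pairs-alternating d []             = alt[ _ ]
down-then-pairs-alternating d (pair u d′ ps) =
  alt∷ (λ eq → up≢down u d (sym eq)) (alt∷ (up≢down u d′) (down-then-pairs-alternating d′ ps))

pairs-alternating : ∀ {w} → UpDownPairs w → Alternating w
pairs-alternating []            = alt[]
pairs-alternating (pair u d ps) = alt∷ (up≢down u d) (down-then-pairs-alternating d ps)

alternating-pairs : ∀ {d h w} → Down d → KPathFrom h w → Alternating (d ∷ w) → UpDownPairs w
alternating-pairs _ kend _                           = []
alternating-pairs d (kN̄ _) (alt∷ ne _)               = ⊥-elim (ne (isUp-Down d))
alternating-pairs d (kĒ _) (alt∷ ne _)               = ⊥-elim (ne (isUp-Down d))
alternating-pairs _ (kN (kN̄ p)) (alt∷ _ (alt∷ _ a))  = pair up-N down-N̄ (alternating-pairs down-N̄ p a)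
alternating-pairs _ (kN (kĒ p)) (alt∷ _ (alt∷ _ a))  = pair up-N down-Ē (alternating-pairs down-Ē p a)
alternating-pairs _ (kE (kN̄ p)) (alt∷ _ (alt∷ _ a))  = pair up-E down-N̄ (alternating-pairs down-N̄ p a)
alternating-pairs _ (kE (kĒ p)) (alt∷ _ (alt∷ _ a))  = pair up-E down-Ē (alternating-pairs down-Ē p a)
alternating-pairs _ (kN (kN _)) (alt∷ _ (alt∷ ne _)) = ⊥-elim (ne refl)
alternating-pairs _ (kN (kE _)) (alt∷ _ (alt∷ ne _)) = ⊥-elim (ne refl)
alternating-pairs _ (kE (kN _)) (alt∷ _ (alt∷ ne _)) = ⊥-elim (ne refl)
alternating-pairs _ (kE (kE _)) (alt∷ _ (alt∷ ne _)) = ⊥-elim (ne refl)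

zigzag-pairs : ∀ {w} → ZigzagKnightPath w → UpDownPairs w
zigzag-pairs (kend , _) = []
zigzag-pairs (p@(kN _) , a) = alternating-pairs down-Ē p (alt∷ (λ ()) a)
zigzag-pairs (p@(kE _) , a) = alternating-pairs down-Ē p (alt∷ (λ ()) a)

word⁺-path : ∀ t {h r} → KPathFrom h r → KPathFrom h (word⁺ t r)
word⁺-path ε           p = p
word⁺-path (NN̄ t)      p = kN (kN̄ (word⁺-path t p))
word⁺-path (EĒ t)      p = kE (kĒ (word⁺-path t p))
word⁺-path (NĒ t EN̄ u) p = kN (kĒ (word⁺-path t (kE (kN̄ (word⁺-path u p)))))

word⁺-pairs : ∀ t {r} → UpDownPairs r → UpDownPairs (word⁺ t r)
word⁺-pairs ε           ps = ps
word⁺-pairs (NN̄ t)      ps = pair up-N down-N̄ (word⁺-pairs t ps)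
word⁺-pairs (EĒ t)      ps = pair up-E down-Ē (word⁺-pairs t ps)
word⁺-pairs (NĒ t EN̄ u) ps = pair up-N down-Ē (word⁺-pairs t (pair up-E down-N̄ (word⁺-pairs u ps)))

word-InR : ∀ t → InR (halfSize t) (word t)
word-InR t =
  (word⁺-path t kend , pairs-alternating (word⁺-pairs t [])) ,
  trans (size-word⁺ t []) (+-identityʳ _)

length-≤-word⁺-EN̄ : ∀ t {w r} → w ≡ word⁺ t (E ∷ N̄ ∷ r) → length r ≤ length w
length-≤-word⁺-EN̄ t {r = r} refl =
  subst (length r ≤_) (sym (length-word⁺ t (E ∷ N̄ ∷ r)))
    (≤-trans (n≤1+n _) (≤-trans (n≤1+n _) (m≤n+m _ (length (word t)))))

-- A maximal parse from height h stops at the end of the path (then h = 0) or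
-- at the pair EN̄ taking the path below h for the first time.
data KnightParseEnd : ℕ → List KStep → Set where
  at-end : KnightParseEnd 0 []
  at-EN̄  : ∀ {h r} → UpDownPairs r → KPathFrom h r → KnightParseEnd (suc h) (E ∷ N̄ ∷ r)

KnightParse : ℕ → List KStep → Set
KnightParse h w = ∃₂ λ t r → w ≡ word⁺ t r × KnightParseEnd h r

parse-knight : ∀ k {h w} → length w ≤ k → UpDownPairs w → KPathFrom h w → KnightParse h w
parse-knight _ _ [] kend = ε , [] , refl , at-end
parse-knight (suc k) (s≤s le) (pair up-N down-N̄ ps) (kN (kN̄ p))
  with parse-knight k (≤-trans (n≤1+n _) le) ps p
... | t , r , eq , end = NN̄ t , r , cong (λ w → N ∷ N̄ ∷ w) eq , end
parse-knight (suc k) (s≤s le) (pair up-E down-Ē ps) (kE (kĒ p))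
  with parse-knight k (≤-trans (n≤1+n _) le) ps p
... | t , r , eq , end = EĒ t , r , cong (λ w → E ∷ Ē ∷ w) eq , end
parse-knight (suc k) _ (pair up-E down-N̄ ps) (kE (kN̄ p)) = ε , _ , refl , at-EN̄ ps p
parse-knight (suc k) (s≤s le) (pair up-N down-Ē ps) (kN (kĒ p))
  with parse-knight k (≤-trans (n≤1+n _) le) ps p
... | t , E ∷ N̄ ∷ r , eq , at-EN̄ ps′ p′
  with parse-knight k (≤-trans (length-≤-word⁺-EN̄ t eq) (≤-trans (n≤1+n _) le)) ps′ p′
...   | u , r′ , eq′ , end′ =
  NĒ t EN̄ u , r′ ,
  cong (λ w → N ∷ Ē ∷ w) (trans eq (cong (λ w → word⁺ t (E ∷ N̄ ∷ w)) eq′)) , end′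

word-surjective : ∀ n {w} → InR n w → Σ ZigzagTree λ t → word t ≡ w × halfSize t ≡ n
word-surjective n {w} (zz@(p , _) , size≡)
  with parse-knight (length w) ≤-refl (zigzag-pairs zz) p
... | t , [] , eq , at-end = t , sym eq , *-cancelˡ-≡ (halfSize t) n 2 size-t
  where
  size-t : 2 * halfSize t ≡ 2 * n
  size-t = trans (sym (trans (size-word⁺ t []) (+-identityʳ _))) (trans (cong size (sym eq)) size≡)

firstReturn-word⁺ : ∀ t h r → firstReturn (suc h) (word⁺ t r) ≡ map₁ (word⁺ t) (firstReturn (suc h) r)
firstReturn-word⁺ ε           h r = refl
firstReturn-word⁺ (NN̄ t)      h r rewrite firstReturn-word⁺ t h r = refl
firstReturn-word⁺ (EĒ t)      h r rewrite firstReturn-word⁺ t h r = refl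
firstReturn-word⁺ (NĒ t EN̄ u) h r
  rewrite firstReturn-word⁺ t (suc h) (E ∷ N̄ ∷ word⁺ u r) | firstReturn-word⁺ u h r = refl

take-length-++ : ∀ {A : Set} (xs ys : List A) → take (length xs) (xs ++ ys) ≡ xs
take-length-++ []       ys = refl
take-length-++ (x ∷ xs) ys = cong (x ∷_) (take-length-++ xs ys)

splitNĒ-word : ∀ t u → splitNĒ (word⁺ t (E ∷ N̄ ∷ word u)) ≡ (word t , word u)
splitNĒ-word t u rewrite firstReturn-word⁺ t 0 (E ∷ N̄ ∷ word u) =
  cong (_, word u) (begin
    take (length (word⁺ t EN̄) ∸ 2) (word⁺ t EN̄)
      ≡⟨ cong (λ w → take (length w ∸ 2) w) (word⁺-++ t [] EN̄) ⟩
    take (length (word t ++ EN̄) ∸ 2) (word t ++ EN̄)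
      ≡⟨ cong (λ l → take (l ∸ 2) (word t ++ EN̄)) (length-++ (word t)) ⟩
    take (length (word t) + 2 ∸ 2) (word t ++ EN̄)
      ≡⟨ cong (λ l → take l (word t ++ EN̄)) (m+n∸n≡m (length (word t)) 2) ⟩
    take (length (word t)) (word t ++ EN̄)
      ≡⟨ take-length-++ (word t) EN̄ ⟩
    word t ∎)
  where
  open ≡-Reasoning
  EN̄ : List KStep
  EN̄ = E ∷ N̄ ∷ []

ψ-fuel-word : ∀ k t → length (word t) ≤ k → ψ-fuel k (word t) ≡ motzkin t
ψ-fuel-word zero    ε _ = refl
ψ-fuel-word (suc k) ε _ = refl
ψ-fuel-word (suc k) (NN̄ t) (s≤s le) = cong (F ∷_) (ψ-fuel-word k t (≤-trans (n≤1+n _) le))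
ψ-fuel-word (suc k) (EĒ t) (s≤s le) = begin
  U ∷ (ψ-fuel k (word t) ++ D ∷ [])
    ≡⟨ cong (λ m → U ∷ (m ++ D ∷ [])) (ψ-fuel-word k t (≤-trans (n≤1+n _) le)) ⟩
  U ∷ (motzkin t ++ D ∷ [])
    ≡⟨ cong (U ∷_) (sym (motzkin⁺-++ t [] (D ∷ []))) ⟩
  U ∷ motzkin⁺ t (D ∷ []) ∎
  where open ≡-Reasoning
ψ-fuel-word (suc k) (NĒ t EN̄ u) (s≤s le) = begin
  ψ-fuel (suc k) (N ∷ Ē ∷ word⁺ t (E ∷ N̄ ∷ word u))
    ≡⟨ cong (λ (β , γ) → U ∷ (ψ-fuel k β ++ D ∷ ψ-fuel k γ)) (splitNĒ-word t u) ⟩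
  U ∷ (ψ-fuel k (word t) ++ D ∷ ψ-fuel k (word u))
    ≡⟨ cong₂ (λ m m′ → U ∷ (m ++ D ∷ m′)) (ψ-fuel-word k t t≤k) (ψ-fuel-word k u u≤k) ⟩
  U ∷ (motzkin t ++ D ∷ motzkin u)
    ≡⟨ cong (U ∷_) (sym (motzkin⁺-++ t [] (D ∷ motzkin u))) ⟩
  U ∷ motzkin⁺ t (D ∷ motzkin u) ∎
  where
  open ≡-Reasoning
  inner≤k : length (word⁺ t (E ∷ N̄ ∷ word u)) ≤ k
  inner≤k = ≤-trans (n≤1+n _) le
  t≤k : length (word t) ≤ k
  t≤k = ≤-trans (length-word-≤-word⁺ t _) inner≤k
  u≤k : length (word u) ≤ k
  u≤k = ≤-trans (length-≤-word⁺-EN̄ t refl) inner≤k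

ψ-word : ∀ t → ψ (word t) ≡ motzkin t
ψ-word t = ψ-fuel-word (length (word t)) t ≤-refl

data Opening : List MStep → Set where
  opens-U : ∀ {m} → Opening (U ∷ m)
  opens-F : ∀ {m} → Opening (F ∷ m)

motzkin⁺-opening : ∀ t r → Opening (motzkin⁺ t r)
motzkin⁺-opening ε           r = opens-F
motzkin⁺-opening (NN̄ t)      r = opens-F
motzkin⁺-opening (EĒ t)      r = opens-U
motzkin⁺-opening (NĒ t EN̄ u) r = opens-U

U∷-peakless : ∀ {m} → Opening m → Peakless m → Peakless (U ∷ m)
U∷-peakless opens-U pl = plUU pl
U∷-peakless opens-F pl = plUF pl

motzkin⁺-path : ∀ t {h r} → MPathFrom h r → MPathFrom h (motzkin⁺ t r)
motzkin⁺-path ε           p = mF p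
motzkin⁺-path (NN̄ t)      p = mF (motzkin⁺-path t p)
motzkin⁺-path (EĒ t)      p = mU (motzkin⁺-path t (mD p))
motzkin⁺-path (NĒ t EN̄ u) p = mU (motzkin⁺-path t (mD (motzkin⁺-path u p)))

motzkin⁺-peakless : ∀ t {r} → Peakless r → Peakless (motzkin⁺ t r)
motzkin⁺-peakless ε           pl = plF pl
motzkin⁺-peakless (NN̄ t)      pl = plF (motzkin⁺-peakless t pl)
motzkin⁺-peakless (EĒ t)      pl =
  U∷-peakless (motzkin⁺-opening t _) (motzkin⁺-peakless t (plD pl))
motzkin⁺-peakless (NĒ t EN̄ u) pl =
  U∷-peakless (motzkin⁺-opening t _) (motzkin⁺-peakless t (plD (motzkin⁺-peakless u pl)))

length-motzkin : ∀ t → length (motzkin t) ≡ suc (halfSize t)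
length-motzkin t = trans (length-motzkin⁺ t []) (cong suc (+-identityʳ _))

motzkin-InM : ∀ t → InM (suc (halfSize t)) (motzkin t)
motzkin-InM t = motzkin⁺-path t mend , motzkin⁺-peakless t pl[] , length-motzkin t

not-opening-≢-motzkin⁺ : ∀ {a} t {b} → ¬ Opening a → a ≢ motzkin⁺ t b
not-opening-≢-motzkin⁺ t {b} ¬o refl = ¬o (motzkin⁺-opening t b)

motzkin⁺-injective : ∀ t t′ {a b} → ¬ Opening a → ¬ Opening b →
                     motzkin⁺ t a ≡ motzkin⁺ t′ b → t ≡ t′ × a ≡ b
motzkin⁺-injective ε ε _ _ refl = refl , refl
motzkin⁺-injective ε (NN̄ t′) ¬oa _ eq =
  ⊥-elim (not-opening-≢-motzkin⁺ t′ ¬oa (proj₂ (∷-injective eq)))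
motzkin⁺-injective (NN̄ t) ε _ ¬ob eq =
  ⊥-elim (not-opening-≢-motzkin⁺ t ¬ob (sym (proj₂ (∷-injective eq))))
motzkin⁺-injective (NN̄ t) (NN̄ t′) ¬oa ¬ob eq
  with motzkin⁺-injective t t′ ¬oa ¬ob (proj₂ (∷-injective eq))
... | refl , a≡b = refl , a≡b
motzkin⁺-injective (EĒ t) (EĒ t′) _ _ eq
  with motzkin⁺-injective t t′ (λ ()) (λ ()) (proj₂ (∷-injective eq))
... | refl , refl = refl , refl
motzkin⁺-injective (EĒ t) (NĒ t′ EN̄ u′) ¬oa _ eq
  with motzkin⁺-injective t t′ (λ ()) (λ ()) (proj₂ (∷-injective eq))
... | refl , a≡u′b = ⊥-elim (not-opening-≢-motzkin⁺ u′ ¬oa (proj₂ (∷-injective a≡u′b)))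
motzkin⁺-injective (NĒ t EN̄ u) (EĒ t′) _ ¬ob eq
  with motzkin⁺-injective t t′ (λ ()) (λ ()) (proj₂ (∷-injective eq))
... | refl , ua≡b = ⊥-elim (not-opening-≢-motzkin⁺ u ¬ob (sym (proj₂ (∷-injective ua≡b))))
motzkin⁺-injective (NĒ t EN̄ u) (NĒ t′ EN̄ u′) ¬oa ¬ob eq
  with motzkin⁺-injective t t′ (λ ()) (λ ()) (proj₂ (∷-injective eq))
... | refl , ua≡u′b with motzkin⁺-injective u u′ ¬oa ¬ob (proj₂ (∷-injective ua≡u′b))
...   | refl , a≡b = refl , a≡b
motzkin⁺-injective ε           (EĒ _)       _ _ ()
motzkin⁺-injective ε           (NĒ _ EN̄ _)  _ _ ()
motzkin⁺-injective (NN̄ _)      (EĒ _)       _ _ ()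
motzkin⁺-injective (NN̄ _)      (NĒ _ EN̄ _)  _ _ ()
motzkin⁺-injective (EĒ _)      ε            _ _ ()
motzkin⁺-injective (EĒ _)      (NN̄ _)       _ _ ()
motzkin⁺-injective (NĒ _ EN̄ _) ε            _ _ ()
motzkin⁺-injective (NĒ _ EN̄ _) (NN̄ _)       _ _ ()

motzkin-injective : ∀ {t t′} → motzkin t ≡ motzkin t′ → t ≡ t′
motzkin-injective {t} {t′} eq = proj₁ (motzkin⁺-injective t t′ (λ ()) (λ ()) eq)

data MotzkinParseEnd : ℕ → List MStep → Set where
  at-end : MotzkinParseEnd 0 []
  at-D   : ∀ {h r} → MPathFrom h r → Peakless r → MotzkinParseEnd (suc h) (D ∷ r)

MotzkinParse : ℕ → List MStep → Set
MotzkinParse h m = ∃₂ λ t r → m ≡ motzkin⁺ t r × MotzkinParseEnd h r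

ends-or-opens : ∀ {h r} → MPathFrom h r → Peakless r → MotzkinParseEnd h r ⊎ Opening r
ends-or-opens mend   _        = inj₁ at-end
ends-or-opens (mD p) (plD pl) = inj₁ (at-D p pl)
ends-or-opens (mU _) _        = inj₂ opens-U
ends-or-opens (mF _) _        = inj₂ opens-F

after-U : ∀ {h m} → MPathFrom (suc h) m → Peakless (U ∷ m) → Opening m × Peakless m
after-U _ (plUU pl) = opens-U , pl
after-U _ (plUF pl) = opens-F , pl
after-U () plU[]

length-≤-motzkin⁺-D : ∀ t {m r} → m ≡ motzkin⁺ t (D ∷ r) → length r ≤ length m
length-≤-motzkin⁺-D t {r = r} refl =
  subst (length r ≤_) (sym (length-motzkin⁺ t (D ∷ r)))
    (≤-trans (n≤1+n _) (m≤n+m _ (suc (halfSize t))))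

parse-motzkin : ∀ k {h m} → length m ≤ k → Opening m → MPathFrom h m → Peakless m → MotzkinParse h m
parse-motzkin (suc k) (s≤s le) opens-F (mF p) (plF pl) with ends-or-opens p pl
... | inj₁ end = ε , _ , refl , end
... | inj₂ o with parse-motzkin k le o p pl
...   | t , r , eq , end = NN̄ t , r , cong (F ∷_) eq , end
parse-motzkin (suc k) (s≤s le) opens-U (mU p) pl with after-U p pl
... | o , pl′ with parse-motzkin k le o p pl′
...   | t , D ∷ r , eq , at-D p′ pl″ with ends-or-opens p′ pl″
...     | inj₁ end = EĒ t , r , cong (U ∷_) eq , end
...     | inj₂ o′ with parse-motzkin k (≤-trans (length-≤-motzkin⁺-D t eq) le) o′ p′ pl″
...       | u , r′ , eq′ , end′ =
  NĒ t EN̄ u , r′ , cong (U ∷_) (trans eq (cong (λ m → motzkin⁺ t (D ∷ m)) eq′)) , end′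

motzkin-surjective : ∀ n {m} → InM (suc n) m → Σ ZigzagTree λ t → motzkin t ≡ m × halfSize t ≡ n
motzkin-surjective n {[]} (_ , _ , ())
motzkin-surjective n {m@(_ ∷ _)} (p , pl , length≡) with ends-or-opens p pl
... | inj₂ o with parse-motzkin (length m) ≤-refl o p pl
...   | t , [] , eq , at-end =
  t , sym eq , suc-injective (trans (sym (length-motzkin t)) (trans (cong length (sym eq)) length≡))

ψ-InR⇒InM : ∀ n {w} → InR n w → InM (suc n) (ψ w)
ψ-InR⇒InM n r with word-surjective n r
... | t , refl , refl = subst (InM _) (sym (ψ-word t)) (motzkin-InM t)

ψ-injective-on-InR : ∀ n {w w′} → InR n w → InR n w′ → ψ w ≡ ψ w′ → w ≡ w′
ψ-injective-on-InR n r r′ eq with word-surjective n r | word-surjective n r′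
... | t , refl , _ | t′ , refl , _ =
  cong word (motzkin-injective (trans (sym (ψ-word t)) (trans eq (ψ-word t′))))

ψ-surjective-onto-InM : ∀ n {m} → InM (suc n) m → Σ (List KStep) λ w → InR n w × ψ w ≡ m
ψ-surjective-onto-InM n mm with motzkin-surjective n mm
... | t , refl , refl = word t , word-InR t , ψ-word t

theorem3 : (n : ℕ) →
    ((w : List KStep) → InR n w → InM (suc n) (ψ w)) ×
    ((w w′ : List KStep) → InR n w → InR n w′ → ψ w ≡ ψ w′ → w ≡ w′) ×
    ((m : List MStep) → InM (suc n) m → Σ (List KStep) (λ w → InR n w × ψ w ≡ m))
theorem3 n =
  (λ _ → ψ-InR⇒InM n) ,
  (λ _ _ → ψ-injective-on-InR n) ,
  (λ _ → ψ-surjective-onto-InM n)
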